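{- Let $n$ be a nonnegative integer. For every integer $x>n+1$, \[ sf^{(n)}(x) \bmod P_{n+2}(x)=0 \iff \sum_{i=1}^{n+1}\left\lfloor \frac{x}{p_{\pi(x)+1}-i}\right\rfloor\left\lfloor \frac{p_{\pi(x)+1}-i}{x}\right\rfloor=0 . \]
   Context: For integers $r\ge 0$ and $m\ge 1$, $P_r(m)=\binom{m+r-1}{r}$ is the $r$-simplex (figurate) number; in particular $P_{n+2}(x)=\binom{x+n+1}{n+2}$. The generalized superfactorial is defined for positive integers $x$ by $sf^{(0)}(x)=x!$ and $sf^{(n)}(x)=\prod_{k=1}^{x}sf^{(n-1)}(k)$ for $n\ge1$. $\pi$ is the prime-counting function and $p_k$ is the $k$th prime, so $p_{\pi(x)+1}$ is the smallest prime greater than $x$. $a \bmod b$ denotes the least nonnegative remainder of $a$ upon division by $b$. -}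

module Defs where

open import Data.Nat using (ℕ; zero; suc; _+_; _*_; _∸_; _/_; _%_; _!)
open import Data.Nat.Combinatorics using (_C_)

sf : ℕ → ℕ → ℕ
sf zero    x       = x !
sf (suc n) zero    = 1
sf (suc n) (suc x) = sf (suc n) x * sf n (suc x)

P : ℕ → ℕ → ℕ
P r m = (m + r ∸ 1) C r

-- floor division and remainder; divisor 0 never occurs in the theorem
-- (all divisors are ≥ 1 under its hypotheses), the 0 case is a dummy.
_div_ : ℕ → ℕ → ℕ
a div zero    = 0
a div (suc b) = a / suc b

_mod_ : ℕ → ℕ → ℕ
a mod zero    = a
a mod (suc b) = a % suc b

sumFrom1 : ℕ → (ℕ → ℕ) → ℕ
sumFrom1 zero    f = 0
sumFrom1 (suc m) f = sumFrom1 m f + f (suc m)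

-- The sum has a nonzero term (equal to 1) exactly when q − i = x for some 1 ≤ i ≤ n+1, that is, when
-- the least prime q above x lies in (x, x+n+1]. In that case q divides P_{n+2}(x) = C(x+n+1, n+2),
-- as it divides (x+n+1)! but neither (n+2)! nor (x−1)!, whereas every prime factor of sfⁿ(x) is at
-- most x. Otherwise induct on n, using (n+2)·C(x+n+1, n+2) = (x+n+1)·C(x+n, n+1) and
-- sfⁿ(x) = sfⁿ(x−1)·sfⁿ⁻¹(x): the composite number M = x+n+1 ≤ 2x−1 divides (n+2)·sfⁿ(x−1), because
-- M = ab with 2 ≤ a ≤ b ≤ x−1, and when a = b the two copies of a are a and 2a in (x−1)! for n = 0
-- (save M = 4, absorbed by n+2 = 2) and come from (x−2)!·(x−1)! for n ≥ 1.

module Submission where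

open import Defs
open import Data.Nat using (ℕ; suc; _+_; _*_; _∸_; _<_)
open import Data.Nat.Primality using (Prime)
open import Data.Product using (_×_)
open import Relation.Binary.PropositionalEquality using (_≡_)
open import Relation.Nullary using (¬_)
open import Function.Bundles using (_⇔_)

open import Data.Nat using (zero; _≤_; z≤n; s≤s; z<s; _!; _/_; _≤?_; nonTrivial⇒n>1; nonTrivial⇒≢1; n>1⇒nonTrivial; >-nonZero⁻¹)
open import Data.Nat.Properties
open import Data.Nat.Divisibility
  using (_∣_; divides; ∣-refl; ∣-reflexive; ∣-trans; 0∣⇒≡0; ∣1⇒≡1; ∣⇒≤; m∣m*n; n∣m*n; ∣n⇒∣m*n;
         *-pres-∣; *-monoʳ-∣; *-cancelˡ-∣; m≤n⇒m!∣n!; m%n≡0⇔n∣m; module ∣-Reasoning)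
open import Data.Nat.DivMod using (m<n⇒m/n≡0; n/n≡1; m/n*n≡m)
open import Data.Nat.Primality using (composite; euclidsLemma; ¬prime⇒composite; prime⇒nonZero; prime⇒nonTrivial)
open import Data.Nat.Combinatorics using (_C_; nCk≡n!/k![n-k]!; k![n∸k]!∣n!; nC1≡n)
open import Data.Product using (∃₂; _,_)
open import Data.Sum using (inj₁; inj₂; [_,_]′; fromInj₁)
open import Data.Empty using (⊥-elim)
open import Function.Base using (_∘_)
open import Relation.Binary.Definitions using (tri<; tri≈; tri>)
open import Relation.Binary.PropositionalEquality using (_≢_; refl; sym; trans; cong; cong₂; subst; module ≡-Reasoning)
open import Relation.Nullary using (yes; no; contradiction)
open import Function.Bundles using (mk⇔; Equivalence)
import Function.Properties.Equivalence as ⇔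
open import Function.Related.Propositional using (module EquationalReasoning)
open import Data.Nat.Tactic.RingSolver using (solve-∀)

m-mod-n≡0⇔n∣m : ∀ m n → m mod n ≡ 0 ⇔ n ∣ m
m-mod-n≡0⇔n∣m m zero    = mk⇔ (λ m≡0 → subst (0 ∣_) (sym m≡0) ∣-refl) 0∣⇒≡0
m-mod-n≡0⇔n∣m m (suc n) = m%n≡0⇔n∣m m (suc n)

m<n⇒m-div-n≡0 : ∀ {m n} → m < n → m div n ≡ 0
m<n⇒m-div-n≡0 {n = suc n} m<n = m<n⇒m/n≡0 m<n

n-div-n≡1 : ∀ {n} → 0 < n → n div n ≡ 1
n-div-n≡1 {suc n} _ = n/n≡1 (suc n)

x-div-m*m-div-x≡0⇔m≢x : ∀ {x m} → 0 < x → (x div m) * (m div x) ≡ 0 ⇔ m ≢ x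
x-div-m*m-div-x≡0⇔m≢x {x} {m} 0<x = mk⇔ to from
  where
  to : (x div m) * (m div x) ≡ 0 → m ≢ x
  to eq refl = contradiction (subst (λ d → d * d ≡ 0) (n-div-n≡1 0<x) eq) λ ()
  from : m ≢ x → (x div m) * (m div x) ≡ 0
  from m≢x with <-cmp m x
  ... | tri< m<x _ _ = trans (cong ((x div m) *_) (m<n⇒m-div-n≡0 m<x)) (*-zeroʳ (x div m))
  ... | tri≈ _ m≡x _ = contradiction m≡x m≢x
  ... | tri> _ _ x<m = cong (_* (m div x)) (m<n⇒m-div-n≡0 x<m)

sumFrom1≡0⇔ : ∀ m f → sumFrom1 m f ≡ 0 ⇔ (∀ i → 0 < i → i ≤ m → f i ≡ 0)
sumFrom1≡0⇔ m f = mk⇔ (to m) (from m)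
  where
  to : ∀ m → sumFrom1 m f ≡ 0 → ∀ i → 0 < i → i ≤ m → f i ≡ 0
  to zero    _  i 0<i i≤0 = contradiction (≤-trans 0<i i≤0) λ ()
  to (suc m) eq i 0<i i≤1+m with m≤n⇒m<n∨m≡n i≤1+m
  ... | inj₁ i<1+m = to m (m+n≡0⇒m≡0 _ eq) i 0<i (≤-pred i<1+m)
  ... | inj₂ refl  = m+n≡0⇒n≡0 (sumFrom1 m f) eq
  from : ∀ m → (∀ i → 0 < i → i ≤ m → f i ≡ 0) → sumFrom1 m f ≡ 0
  from zero    _ = refl
  from (suc m) h =
    cong₂ _+_ (from m λ i 0<i i≤m → h i 0<i (m≤n⇒m≤1+n i≤m)) (h (suc m) z<s ≤-refl)

q∸i≢x⇔m+x<q : ∀ {m x q} → x < q → (∀ i → 0 < i → i ≤ m → q ∸ i ≢ x) ⇔ m + x < q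
q∸i≢x⇔m+x<q {m} {x} {q} x<q = mk⇔ to from
  where
  to : (∀ i → 0 < i → i ≤ m → q ∸ i ≢ x) → m + x < q
  to h with q ≤? m + x
  ... | no  q≰m+x = ≰⇒> q≰m+x
  ... | yes q≤m+x = contradiction (m∸[m∸n]≡n (<⇒≤ x<q))
                      (h (q ∸ x) (m<n⇒0<n∸m x<q) (m≤n+o⇒m∸n≤o q x (subst (q ≤_) (+-comm m x) q≤m+x)))
  from : m + x < q → ∀ i → 0 < i → i ≤ m → q ∸ i ≢ x
  from m+x<q i _ i≤m = >⇒≢ (m+n≤o⇒m≤o∸n (suc x) x+i<q)
    where
    x+i<q : suc x + i ≤ q
    x+i<q = ≤-trans (s≤s (subst (_≤ m + x) (+-comm i x) (+-monoˡ-≤ x i≤m))) m+x<q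

prime∤1 : ∀ {p} → Prime p → ¬ p ∣ 1
prime∤1 pp p∣1 = contradiction (∣1⇒≡1 p∣1) (nonTrivial⇒≢1 {{prime⇒nonTrivial pp}})

m≤n⇒m∣n! : ∀ {m n} → 0 < m → m ≤ n → m ∣ n !
m≤n⇒m∣n! {suc m} _ m≤n = ∣-trans (m∣m*n (m !)) (m≤n⇒m!∣n! m≤n)

m<n≤o⇒m*n∣o! : ∀ {m n o} → 0 < m → m < n → n ≤ o → m * n ∣ o !
m<n≤o⇒m*n∣o! {m} {suc n} 0<m (s≤s m≤n) n<o =
  ∣-trans (subst (m * suc n ∣_) (*-comm (n !) (suc n)) (*-pres-∣ (m≤n⇒m∣n! 0<m m≤n) ∣-refl))
          (m≤n⇒m!∣n! n<o)

prime∣n!⇒p≤n : ∀ {p} → Prime p → ∀ n → p ∣ n ! → p ≤ n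
prime∣n!⇒p≤n pp zero    p∣1 = contradiction p∣1 (prime∤1 pp)
prime∣n!⇒p≤n pp (suc n) p∣n! with euclidsLemma (suc n) (n !) pp p∣n!
... | inj₁ p∣1+n = ∣⇒≤ p∣1+n
... | inj₂ p∣n!  = m≤n⇒m≤1+n (prime∣n!⇒p≤n pp n p∣n!)

n!∣sf : ∀ n k → k ! ∣ sf n k
n!∣sf zero    k       = ∣-refl
n!∣sf (suc n) zero    = ∣-refl
n!∣sf (suc n) (suc k) = ∣n⇒∣m*n (sf (suc n) k) (n!∣sf n (suc k))

n!*[1+n]!∣sf[1+k] : ∀ k n → n ! * suc n ! ∣ sf (suc k) (suc n)
n!*[1+n]!∣sf[1+k] k n = *-pres-∣ (n!∣sf (suc k) n) (n!∣sf k (suc n))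

prime∣sf⇒p≤x : ∀ {p} → Prime p → ∀ n x → p ∣ sf n x → p ≤ x
prime∣sf⇒p≤x pp zero    x       p∣x! = prime∣n!⇒p≤n pp x p∣x!
prime∣sf⇒p≤x pp (suc n) zero    p∣1  = contradiction p∣1 (prime∤1 pp)
prime∣sf⇒p≤x pp (suc n) (suc x) p∣sf with euclidsLemma (sf (suc n) x) (sf n (suc x)) pp p∣sf
... | inj₁ p∣sf[1+n]x = m≤n⇒m≤1+n (prime∣sf⇒p≤x pp (suc n) x p∣sf[1+n]x)
... | inj₂ p∣sfn[1+x] = prime∣sf⇒p≤x pp n (suc x) p∣sfn[1+x]

nCk*[k!*[n∸k]!]≡n! : ∀ {n k} → k ≤ n → (n C k) * (k ! * (n ∸ k) !) ≡ n !
nCk*[k!*[n∸k]!]≡n! {n} {k} k≤n = begin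
  (n C k) * (k ! * (n ∸ k) !)                      ≡⟨ cong (_* (k ! * (n ∸ k) !)) (nCk≡n!/k![n-k]! k≤n) ⟩
  (n ! / (k ! * (n ∸ k) !)) * (k ! * (n ∸ k) !)  ≡⟨ m/n*n≡m (k![n∸k]!∣n! k≤n) ⟩
  n !                                              ∎
  where open ≡-Reasoning; instance _ = k !* (n ∸ k) !≢0

[1+k]*[1+n]C[1+k]≡[1+n]*nCk : ∀ {n k} → k ≤ n → suc k * (suc n C suc k) ≡ suc n * (n C k)
[1+k]*[1+n]C[1+k]≡[1+n]*nCk {n} {k} k≤n = *-cancelʳ-≡ _ _ (k ! * (n ∸ k) !) eq
  where
  instance _ = k !* (n ∸ k) !≢0
  open ≡-Reasoning
  regroup : ∀ a b c d → a * b * (c * d) ≡ b * (a * c * d)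
  regroup = solve-∀
  eq : suc k * (suc n C suc k) * (k ! * (n ∸ k) !) ≡ suc n * (n C k) * (k ! * (n ∸ k) !)
  eq = begin
    suc k * (suc n C suc k) * (k ! * (n ∸ k) !)   ≡⟨ regroup (suc k) (suc n C suc k) (k !) ((n ∸ k) !) ⟩
    (suc n C suc k) * (suc k * k ! * (n ∸ k) !)   ≡⟨ nCk*[k!*[n∸k]!]≡n! (s≤s k≤n) ⟩
    suc n * n !                                   ≡⟨ cong (suc n *_) (nCk*[k!*[n∸k]!]≡n! k≤n) ⟨
    suc n * ((n C k) * (k ! * (n ∸ k) !))         ≡⟨ *-assoc (suc n) (n C k) _ ⟨
    suc n * (n C k) * (k ! * (n ∸ k) !)           ∎

prime∣nCk : ∀ {p n k} → Prime p → p ≤ n → k < p → n ∸ k < p → p ∣ n C k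
prime∣nCk {p} {n} {k} pp p≤n k<p n∸k<p =
  fromInj₁ (⊥-elim ∘ p∤k!*[n∸k]!) (euclidsLemma (n C k) (k ! * (n ∸ k) !) pp p∣nCk*k!*[n∸k]!)
  where
  p∣nCk*k!*[n∸k]! : p ∣ (n C k) * (k ! * (n ∸ k) !)
  p∣nCk*k!*[n∸k]! = subst (p ∣_) (sym (nCk*[k!*[n∸k]!]≡n! (≤-trans (<⇒≤ k<p) p≤n)))
                      (m≤n⇒m∣n! (>-nonZero⁻¹ p {{prime⇒nonZero pp}}) p≤n)
  p∤m!<p : ∀ {m} → m < p → ¬ p ∣ m !
  p∤m!<p m<p p∣m! = <⇒≱ m<p (prime∣n!⇒p≤n pp _ p∣m!)
  p∤k!*[n∸k]! : ¬ p ∣ k ! * (n ∸ k) !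
  p∤k!*[n∸k]! d = [ p∤m!<p k<p , p∤m!<p n∸k<p ]′ (euclidsLemma (k !) ((n ∸ k) !) pp d)

m<n*m⇒1<n : ∀ {m n} → m < n * m → 1 < n
m<n*m⇒1<n {m} {n} m<n*m = *-cancelʳ-< m 1 n (subst (_< n * m) (sym (*-identityˡ m)) m<n*m)

¬prime⇒factorisation : ∀ {m} → 1 < m → ¬ Prime m → ∃₂ λ a b → 2 ≤ a × a ≤ b × m ≡ a * b
¬prime⇒factorisation 1<m ¬prime with ¬prime⇒composite {{n>1⇒nonTrivial 1<m}} ¬prime
... | composite {d} d<m (divides e m≡e*d) with ≤-total d e
...   | inj₁ d≤e = d , e , nonTrivial⇒n>1 d , d≤e , trans m≡e*d (*-comm e d)
...   | inj₂ e≤d = e , d , m<n*m⇒1<n (subst (d <_) m≡e*d d<m) , e≤d , m≡e*d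

2≤m⇒m*n≤1+2*o⇒n≤o : ∀ {m n o} → 2 ≤ m → m * n ≤ suc (2 * o) → n ≤ o
2≤m⇒m*n≤1+2*o⇒n≤o {m} {n} {o} 2≤m le = ≤-pred (*-cancelˡ-< 2 n (suc o) (begin-strict
  2 * n       ≤⟨ *-monoˡ-≤ n 2≤m ⟩
  m * n       ≤⟨ le ⟩
  suc (2 * o) <⟨ n<1+n _ ⟩
  2 + 2 * o   ≡⟨ *-suc 2 o ⟨
  2 * suc o   ∎))
  where open ≤-Reasoning

[1+n]+[1+y]≤1+2*y : ∀ {n y} → n < y → suc n + suc y ≤ suc (2 * y)
[1+n]+[1+y]≤1+2*y {n} {y} n<y = s≤s (begin
  n + suc y ≡⟨ +-suc n y ⟩
  suc n + y ≤⟨ +-monoˡ-≤ y n<y ⟩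
  y + y     ≡⟨ cong (y +_) (+-identityʳ y) ⟨
  2 * y     ∎)
  where open ≤-Reasoning

square∣[2+n]*sf : ∀ n y {a} → n < y → 2 ≤ a → a * a ≡ suc n + suc y → a * a ∣ (2 + n) * sf n y
square∣[2+n]*sf zero .2 {2} _ _ refl = ∣-refl
square∣[2+n]*sf zero y {a@(suc (suc (suc _)))} _ _ a*a≡2+y =
  ∣n⇒∣m*n 2 (∣-trans (*-monoʳ-∣ a (n∣m*n 2 {a})) (m<n≤o⇒m*n∣o! z<s (m<m+n a z<s) 2*a≤y))
  where
  3≤a : 3 ≤ a
  3≤a = s≤s (s≤s (s≤s z≤n))
  2*a≤y : 2 * a ≤ y
  2*a≤y = <⇒≤ (≤-pred (≤-pred (begin
    3 + 2 * a ≤⟨ +-monoˡ-≤ (2 * a) 3≤a ⟩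
    3 * a     ≤⟨ *-monoˡ-≤ a 3≤a ⟩
    a * a     ≡⟨ a*a≡2+y ⟩
    2 + y     ∎)))
    where open ≤-Reasoning
square∣[2+n]*sf (suc n) zero ()
square∣[2+n]*sf (suc n) (suc z) {2} n<y _ 4≡M =
  contradiction (subst (5 ≤_) (sym 4≡M) 5≤M) 1+n≰n
  where
  5≤M : 5 ≤ suc (suc n) + suc (suc z)
  5≤M = ≤-trans (s≤s (s≤s (s≤s (s≤s (≤-trans (s≤s z≤n) (≤-pred n<y))))))
                (+-monoˡ-≤ (2 + z) (s≤s (s≤s z≤n)))
square∣[2+n]*sf (suc n) (suc z) {a@(suc (suc (suc _)))} n<y _ a*a≡M =
  ∣n⇒∣m*n (3 + n) (∣-trans (*-pres-∣ (m≤n⇒m∣n! z<s a≤z) (m≤n⇒m∣n! z<s (m≤n⇒m≤1+n a≤z)))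
                            (n!*[1+n]!∣sf[1+k] n z))
  where
  3≤a : 3 ≤ a
  3≤a = s≤s (s≤s (s≤s z≤n))
  a≤z : a ≤ z
  a≤z = ≤-pred (*-cancelˡ-< 3 a (suc z) (begin-strict
    3 * a                     ≤⟨ *-monoˡ-≤ a 3≤a ⟩
    a * a                     ≡⟨ a*a≡M ⟩
    suc (suc n) + suc (suc z) ≤⟨ [1+n]+[1+y]≤1+2*y n<y ⟩
    suc (2 * suc z)           <⟨ +-monoˡ-≤ (2 * suc z) (≤-trans (s≤s (s≤s z≤n)) n<y) ⟩
    3 * suc z                 ∎))
    where open ≤-Reasoning

composite∣[2+n]*sf : ∀ n y → n < y → ¬ Prime (suc n + suc y) → suc n + suc y ∣ (2 + n) * sf n y
composite∣[2+n]*sf n y n<y ¬prime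
  with a , b , 2≤a , a≤b , M≡a*b ← ¬prime⇒factorisation (s≤s (≤-trans z<s (m≤n+m (suc y) n))) ¬prime
  with m≤n⇒m<n∨m≡n a≤b
... | inj₁ a<b = subst (_∣ (2 + n) * sf n y) (sym M≡a*b)
                   (∣n⇒∣m*n (2 + n) (∣-trans (m<n≤o⇒m*n∣o! (<⇒≤ 2≤a) a<b b≤y) (n!∣sf n y)))
  where
  b≤y : b ≤ y
  b≤y = 2≤m⇒m*n≤1+2*o⇒n≤o 2≤a (subst (_≤ suc (2 * y)) M≡a*b ([1+n]+[1+y]≤1+2*y n<y))
... | inj₂ refl = subst (_∣ (2 + n) * sf n y) (sym M≡a*b) (square∣[2+n]*sf n y n<y 2≤a (sym M≡a*b))

-- sf′ n stands for sf^{(n-1)}, with sf^{(-1)}(x) = x, so that sf-suc holds for every n.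
sf′ : ℕ → ℕ → ℕ
sf′ zero    x = x
sf′ (suc n) x = sf n x

sf-suc : ∀ n y → sf n (suc y) ≡ sf n y * sf′ n (suc y)
sf-suc zero    y = *-comm (suc y) (y !)
sf-suc (suc n) y = refl

binomial∣sf′ : ∀ n x → n < x → (∀ j → 0 < j → j ≤ n → ¬ Prime (j + x)) → (n + x) C suc n ∣ sf′ n x
binomial∣sf′ zero    x       _         _          = ∣-reflexive (nC1≡n x)
binomial∣sf′ (suc n) (suc y) (s≤s n<y) prime-free = *-cancelˡ-∣ (2 + n) (begin
  (2 + n) * ((suc n + suc y) C (2 + n))            ≡⟨ [1+k]*[1+n]C[1+k]≡[1+n]*nCk 1+n≤n+[1+y] ⟩
  (suc n + suc y) * ((n + suc y) C suc n)          ∣⟨ *-pres-∣ M∣[2+n]*sf IH ⟩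
  (2 + n) * sf n y * sf′ n (suc y)                 ≡⟨ *-assoc (2 + n) (sf n y) (sf′ n (suc y)) ⟩
  (2 + n) * (sf n y * sf′ n (suc y))               ≡⟨ cong ((2 + n) *_) (sf-suc n y) ⟨
  (2 + n) * sf n (suc y)                           ∎)
  where
  open ∣-Reasoning
  1+n≤n+[1+y] : suc n ≤ n + suc y
  1+n≤n+[1+y] = subst (suc n ≤_) (sym (+-suc n y)) (s≤s (m≤m+n n y))
  IH : (n + suc y) C suc n ∣ sf′ n (suc y)
  IH = binomial∣sf′ n (suc y) (m<n⇒m<1+n n<y) λ j 0<j j≤n → prime-free j 0<j (m≤n⇒m≤1+n j≤n)
  M∣[2+n]*sf : suc n + suc y ∣ (2 + n) * sf n y
  M∣[2+n]*sf = composite∣[2+n]*sf n y n<y (prime-free (suc n) z<s ≤-refl)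

[1+n+x]C[2+n]∣sf⇔1+n+x<q : ∀ n x q → suc n < x → Prime q → x < q → (∀ r → Prime r → x < r → ¬ r < q) →
                             (suc n + x) C (2 + n) ∣ sf n x ⇔ suc n + x < q
[1+n+x]C[2+n]∣sf⇔1+n+x<q n x q n+1<x prime-q x<q q-least = mk⇔ to from
  where
  to : (suc n + x) C (2 + n) ∣ sf n x → suc n + x < q
  to C∣sf = ≰⇒> λ q≤1+n+x → <⇒≱ x<q (prime∣sf⇒p≤x prime-q n x (∣-trans (q∣C q≤1+n+x) C∣sf))
    where
    q∣C : q ≤ suc n + x → q ∣ (suc n + x) C (2 + n)
    q∣C q≤1+n+x = prime∣nCk prime-q q≤1+n+x (≤-<-trans n+1<x x<q)
      (≤-<-trans (≤-trans (∸-monoʳ-≤ (n + x) (n≤1+n n)) (≤-reflexive (m+n∸m≡n n x))) x<q)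
  from : suc n + x < q → (suc n + x) C (2 + n) ∣ sf n x
  from gap = binomial∣sf′ (suc n) x n+1<x λ j 0<j j≤1+n prime-j →
    q-least (j + x) prime-j (m<n+m x 0<j) (≤-<-trans (+-monoˡ-≤ x j≤1+n) gap)

Σ⌊x/[q∸i]⌋⌊[q∸i]/x⌋≡0⇔m+x<q : ∀ m {x q} → 0 < x → x < q →
                                sumFrom1 m (λ i → (x div (q ∸ i)) * ((q ∸ i) div x)) ≡ 0 ⇔ m + x < q
Σ⌊x/[q∸i]⌋⌊[q∸i]/x⌋≡0⇔m+x<q m {x} {q} 0<x x<q =
  ⇔.trans (sumFrom1≡0⇔ m _) (⇔.trans termwise (q∸i≢x⇔m+x<q x<q))
  where
  termwise : (∀ i → 0 < i → i ≤ m → (x div (q ∸ i)) * ((q ∸ i) div x) ≡ 0) ⇔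
             (∀ i → 0 < i → i ≤ m → q ∸ i ≢ x)
  termwise = mk⇔ (λ h i 0<i i≤m → Equivalence.to   (x-div-m*m-div-x≡0⇔m≢x 0<x) (h i 0<i i≤m))
                 (λ h i 0<i i≤m → Equivalence.from (x-div-m*m-div-x≡0⇔m≢x 0<x) (h i 0<i i≤m))

P[1+r]m≡[r+m]C[1+r] : ∀ r m → P (suc r) m ≡ (r + m) C suc r
P[1+r]m≡[r+m]C[1+r] r m = cong (_C suc r) (trans (cong (_∸ 1) (+-suc m r)) (+-comm m r))

theorem7p5 : (n x : ℕ) → suc n < x →
    (q : ℕ) → Prime q → x < q → (∀ r → Prime r → x < r → ¬ (r < q)) →
    (sf n x mod P (n + 2) x ≡ 0) ⇔
      (sumFrom1 (suc n) (λ i → (x div (q ∸ i)) * ((q ∸ i) div x)) ≡ 0)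
theorem7p5 n x n+1<x q prime-q x<q q-least = begin
  sf n x mod P (n + 2) x ≡ 0       ∼⟨ m-mod-n≡0⇔n∣m (sf n x) (P (n + 2) x) ⟩
  P (n + 2) x ∣ sf n x             ≡⟨ cong (λ r → P r x ∣ sf n x) (+-comm n 2) ⟩
  P (2 + n) x ∣ sf n x             ≡⟨ cong (_∣ sf n x) (P[1+r]m≡[r+m]C[1+r] (suc n) x) ⟩
  (suc n + x) C (2 + n) ∣ sf n x   ∼⟨ [1+n+x]C[2+n]∣sf⇔1+n+x<q n x q n+1<x prime-q x<q q-least ⟩
  suc n + x < q                    ∼⟨ ⇔.sym (Σ⌊x/[q∸i]⌋⌊[q∸i]/x⌋≡0⇔m+x<q (suc n) (<-trans z<s n+1<x) x<q) ⟩
  sumFrom1 (suc n) (λ i → (x div (q ∸ i)) * ((q ∸ i) div x)) ≡ 0 ∎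
  where open EquationalReasoning
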